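{- Let $n\ge2$, let $\Gamma_p=\{\mathrm{NAND}^n,\ \mathrm{Imp}\}$, and let $\Gamma_w=\{R_w\}$ where $R_w$ is the $(n+2)$-ary Boolean relation $R_w(x_1,\dots,x_n,x,c_0)\equiv\mathrm{NAND}^n(x_1,\dots,x_n)\wedge\big(\neg x\to(\neg x_1\wedge\dots\wedge\neg x_n)\big)\wedge(c_0=0)$. Then $\langle\Gamma_w\rangle_{\mathrm{fr}}\subsetneq\langle\Gamma_p\rangle_{\mathrm{fr}}$.
   Context: $\mathrm{NAND}^n=\{0,1\}^n\setminus\{(1,\dots,1)\}$ and $\mathrm{Imp}=\{(0,0),(0,1),(1,1)\}$ (the relation $x_1\to x_2$). Both $\Gamma_p$ and $\Gamma_w$ are bases of the co-clone $\mathrm{IS}^n_{11}$. A frozen pp-definition (fpp-definition) of an $m$-ary relation $R$ over $\Gamma$ is a formula $R(z_1,\dots,z_m)\equiv\exists y_1,\dots,y_l\colon R_1(\mathbf{x}_1)\wedge\dots\wedge R_k(\mathbf{x}_k)$ with $R_j\in\Gamma\cup\{\mathrm{Eq}\}$ (equality relation) and $\mathbf{x}_j$ tuples of variables among $z_1,\dots,z_m,y_1,\dots,y_l$, such that each $y_j$ takes the same constant value in every satisfying assignment of the conjunction; $\langle\Gamma\rangle_{\mathrm{fr}}$ is the set of relations fpp-definable over $\Gamma$. -}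

module Defs where

open import Data.Nat using (ℕ; suc; _+_)
open import Data.Bool using (Bool; true; false; _∧_; _∨_; not)
open import Data.Fin using (Fin; zero; suc; _↑ˡ_; _↑ʳ_)
open import Data.Unit using (⊤; tt)
open import Data.Product using (Σ; ∃; _×_; _,_)
open import Data.List using (List)
open import Data.List.Relation.Unary.All using (All)
open import Data.Vec.Functional using (Vector; _++_; foldr)
open import Relation.Binary.PropositionalEquality using (_≡_)
open import Relation.Nullary using (¬_)
open import Function.Bundles using (_⇔_)

BRel : ℕ → Set
BRel m = (Fin m → Bool) → Bool

record Lang : Set₁ where
  field
    Sym : Set
    ar  : Sym → ℕ
    rel : (s : Sym) → BRel (ar s)
open Lang public

data Atom (Γ : Lang) (v : ℕ) : Set where
  rAtom  : (s : Sym Γ) → (Fin (ar Γ s) → Fin v) → Atom Γ v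
  eqAtom : Fin v → Fin v → Atom Γ v

satAtom : {Γ : Lang} {v : ℕ} → (Fin v → Bool) → Atom Γ v → Set
satAtom {Γ} σ (rAtom s xs) = rel Γ s (λ i → σ (xs i)) ≡ true
satAtom σ (eqAtom x y) = σ x ≡ σ y

Sat : {Γ : Lang} {v : ℕ} → List (Atom Γ v) → (Fin v → Bool) → Set
Sat φ σ = All (satAtom σ) φ

-- R(z_1..z_m) ≡ ∃ y_1..y_l . φ(z, y) with every y_j frozen
-- (constant over all satisfying assignments of φ).
-- Variables 0..m-1 are z_1..z_m, variables m..m+l-1 are y_1..y_l.
FppDef : (Γ : Lang) {m : ℕ} → BRel m → Set
FppDef Γ {m} R =
  Σ ℕ λ l → Σ (List (Atom Γ (m + l))) λ φ →
    ((z : Fin m → Bool) → (R z ≡ true) ⇔ (Σ (Fin l → Bool) λ y → Sat φ (z ++ y)))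
    × ((j : Fin l) → Σ Bool λ b →
         (z : Fin m → Bool) (y : Fin l → Bool) → Sat φ (z ++ y) → y j ≡ b)

_⊆fr_ : Lang → Lang → Set
Γ ⊆fr Δ = (m : ℕ) (R : BRel m) → FppDef Γ R → FppDef Δ R

_⊊fr_ : Lang → Lang → Set
Γ ⊊fr Δ = (Γ ⊆fr Δ) × (Σ ℕ λ m → Σ (BRel m) λ R → FppDef Δ R × ¬ FppDef Γ R)

allB : {n : ℕ} → (Fin n → Bool) → Bool
allB = foldr _∧_ true

NAND : (n : ℕ) → BRel n
NAND n t = not (allB t)

Imp : BRel 2
Imp t = not (t zero) ∨ t (suc zero)

Rw : (n : ℕ) → BRel (n + 2)
Rw n t = NAND n xs ∧ (x ∨ allB (λ i → not (xs i))) ∧ not c0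
  where
    xs : Fin n → Bool
    xs i = t (i ↑ˡ 2)
    x  = t (n ↑ʳ zero)
    c0 = t (n ↑ʳ suc zero)

data PSym : Set where
  nandS impS : PSym

Γp : ℕ → Lang
Γp n = record { Sym = PSym ; ar = arP ; rel = relP }
  where
    arP : PSym → ℕ
    arP nandS = n
    arP impS  = 2
    relP : (s : PSym) → BRel (arP s)
    relP nandS = NAND n
    relP impS  = Imp

Γw : ℕ → Lang
Γw n = record { Sym = ⊤ ; ar = λ _ → n + 2 ; rel = λ _ → Rw n }

-- Each R_w-atom is equivalent to a conjunction of NAND^n- and Imp-atoms on the same
-- variables (with c₀ = 0 written as NAND^n(c₀, …, c₀)), so a frozen pp-definition over
-- Γ_w translates atom by atom into one over Γ_p with the same frozen variables.
-- Conversely, R_w and Eq are 0-valid and closed under the union of two disjoint tuples: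
-- a tuple of R_w with x = 0 is the zero tuple, and of two disjoint tuples at most one
-- has x = 1, so the union is one of them. Since the all-zero assignment satisfies every
-- Γ_w-formula, all frozen variables are frozen to 0, and hence every relation in
-- ⟨Γ_w⟩_fr is closed under disjoint unions. NAND^n is not once n ≥ 2:
-- (1,0,…,0) ∪ (0,1,…,1) = (1,…,1).
module Submission where

open import Defs
open import Data.Nat using (ℕ; zero; suc; _+_; _≤_; s≤s)
open import Data.Bool using (Bool; true; false; _∧_; _∨_; not)
open import Data.Bool.Properties using (∨-identityʳ; ∨-zeroʳ; not-¬)
open import Data.Fin using (Fin; zero; suc; _↑ˡ_; _↑ʳ_; splitAt; join)
open import Data.Fin.Properties using (join-splitAt)
open import Data.Sum using (_⊎_; inj₁; inj₂)
open import Data.Product using (Σ; _×_; _,_; proj₁; proj₂; map₂)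
open import Data.List using (List; []; _∷_; [_]; map; concatMap; tabulate)
import Data.List.Relation.Unary.All as All
open import Data.List.Relation.Unary.All using ([]; _∷_)
open import Data.List.Relation.Unary.All.Properties
  using (map⁺; map⁻; concat⁺; concat⁻; tabulate⁺; tabulate⁻)
open import Data.Vec.Functional using (Vector; _++_; zipWith)
  renaming ([] to []ᵛ; _∷_ to _∷ᵛ_)
open import Data.Vec.Functional.Properties using (++-cong; lookup-++ˡ)
open import Function using (_∘_; const; id)
open import Function.Bundles using (_⇔_; mk⇔; Equivalence)
open import Function.Construct.Composition using (_⇔-∘_)
open import Function.Construct.Symmetry using (⇔-sym)
open import Relation.Binary.PropositionalEquality
  using (_≡_; _≗_; refl; sym; trans; cong; cong₂; subst)
open import Relation.Nullary using (¬_)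

open Equivalence using (to; from)

∧-≡-true : ∀ a {b} → a ∧ b ≡ true → a ≡ true × b ≡ true
∧-≡-true true p = refl , p

≡-true-∧ : ∀ {a b} → a ≡ true → b ≡ true → a ∧ b ≡ true
≡-true-∧ refl refl = refl

not-≡-true : ∀ {b} → not b ≡ true → b ≡ false
not-≡-true {false} _ = refl

allB-≡-true : ∀ {m} {f : Fin m → Bool} → allB f ≡ true ⇔ (∀ i → f i ≡ true)
allB-≡-true = mk⇔ elim intro
  where
  elim : ∀ {m} {f : Fin m → Bool} → allB f ≡ true → ∀ i → f i ≡ true
  elim {f = f} p zero    = proj₁ (∧-≡-true (f zero) p)
  elim {f = f} p (suc i) = elim (proj₂ (∧-≡-true (f zero) p)) i

  intro : ∀ {m} {f : Fin m → Bool} → (∀ i → f i ≡ true) → allB f ≡ true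
  intro {zero}  h = refl
  intro {suc m} h = ≡-true-∧ (h zero) (intro (h ∘ suc))

allB-const-true : ∀ {m} → allB {m} (const true) ≡ true
allB-const-true {m} = from (allB-≡-true {m}) (λ _ → refl)

allB-cong : ∀ {m} {f g : Fin m → Bool} → f ≗ g → allB f ≡ allB g
allB-cong {zero}  eq = refl
allB-cong {suc m} eq = cong₂ _∧_ (eq zero) (allB-cong (eq ∘ suc))

∨-allB : ∀ {m} x (f : Fin m → Bool) → x ∨ allB f ≡ allB (λ i → f i ∨ x)
∨-allB true  f = sym (from allB-≡-true (∨-zeroʳ ∘ f))
∨-allB false f = allB-cong (sym ∘ ∨-identityʳ ∘ f)

Congruent : ∀ {m} → BRel m → Set
Congruent R = ∀ {σ τ} → σ ≗ τ → R σ ≡ R τ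

NAND-cong : ∀ {m} → Congruent (NAND m)
NAND-cong eq = cong not (allB-cong eq)

NAND-const-true : ∀ {m} → NAND m (const true) ≡ false
NAND-const-true {m} = cong not (allB-const-true {m})

NAND-const : ∀ {k} c → NAND (suc k) (const c) ≡ not c
NAND-const false = refl
NAND-const {k} true = NAND-const-true {suc k}

↑-elim : ∀ m {n} {P : Fin (m + n) → Set} →
         (∀ i → P (i ↑ˡ n)) → (∀ j → P (m ↑ʳ j)) → ∀ k → P k
↑-elim m {n} {P} left right k = subst P (join-splitAt m n k) (byCase (splitAt m k))
  where
  byCase : (s : Fin m ⊎ Fin n) → P (join m n s)
  byCase (inj₁ i) = left i
  byCase (inj₂ j) = right j

zipWith-++ : ∀ {A B C : Set} {m l} (f : A → B → C)
             (x₁ : Vector A m) (y₁ : Vector A l) (x₂ : Vector B m) (y₂ : Vector B l) →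
             zipWith f (x₁ ++ y₁) (x₂ ++ y₂) ≗ zipWith f x₁ x₂ ++ zipWith f y₁ y₂
zipWith-++ {m = m} f x₁ y₁ x₂ y₂ i with splitAt m i
... | inj₁ _ = refl
... | inj₂ _ = refl

++-const : ∀ {A : Set} {m l} {a : A} {x : Vector A m} {y : Vector A l} →
           x ≗ const a → y ≗ const a → x ++ y ≗ const a
++-const {m = m} x≗a y≗a i with splitAt m i
... | inj₁ j = x≗a j
... | inj₂ j = y≗a j

_∪_ : ∀ {m} → (Fin m → Bool) → (Fin m → Bool) → Fin m → Bool
_∪_ = zipWith _∨_

Disjoint : ∀ {m} → (Fin m → Bool) → (Fin m → Bool) → Set
Disjoint σ τ = zipWith _∧_ σ τ ≗ const false

ZeroValid : ∀ {m} → BRel m → Set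
ZeroValid R = ∀ {σ} → σ ≗ const false → R σ ≡ true

-- The union is only given up to ≗: a BRel need not respect pointwise equality.
UnionClosed : ∀ {m} → BRel m → Set
UnionClosed R = ∀ σ τ ρ → Disjoint σ τ → ρ ≗ σ ∪ τ →
                R σ ≡ true → R τ ≡ true → R ρ ≡ true

ZeroValidLang : Lang → Set
ZeroValidLang Γ = ∀ s → ZeroValid (rel Γ s)

UnionClosedLang : Lang → Set
UnionClosedLang Γ = ∀ s → UnionClosed (rel Γ s)

Sat-zero : ∀ {Γ v} {σ : Fin v → Bool} → ZeroValidLang Γ →
           (φ : List (Atom Γ v)) → σ ≗ const false → Sat φ σ
Sat-zero {σ = σ} zv φ σ≗0 = All.universal satAtom-zero φ
  where
  satAtom-zero : ∀ a → satAtom σ a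
  satAtom-zero (rAtom s xs) = zv s (σ≗0 ∘ xs)
  satAtom-zero (eqAtom x y) = trans (σ≗0 x) (sym (σ≗0 y))

Sat-union : ∀ {Γ v} {σ τ ρ : Fin v → Bool} → UnionClosedLang Γ →
            (φ : List (Atom Γ v)) → Disjoint σ τ → ρ ≗ σ ∪ τ →
            Sat φ σ → Sat φ τ → Sat φ ρ
Sat-union {σ = σ} {τ} {ρ} uc φ σ∩τ ρ≗σ∪τ Sσ Sτ =
  All.zipWith (λ {a} (p , q) → satAtom-union a p q) (Sσ , Sτ)
  where
  satAtom-union : ∀ a → satAtom σ a → satAtom τ a → satAtom ρ a
  satAtom-union (rAtom s xs) p q =
    uc s (σ ∘ xs) (τ ∘ xs) (ρ ∘ xs) (σ∩τ ∘ xs) (ρ≗σ∪τ ∘ xs) p q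
  satAtom-union (eqAtom x y) p q =
    trans (ρ≗σ∪τ x) (trans (cong₂ _∨_ p q) (sym (ρ≗σ∪τ y)))

fppDef-unionClosed : ∀ {Γ m} {R : BRel m} → ZeroValidLang Γ → UnionClosedLang Γ →
                     FppDef Γ R → UnionClosed R
fppDef-unionClosed {m = m} zv uc (l , φ , R⇔ , frozen) σ τ ρ σ∩τ ρ≗σ∪τ Rσ Rτ
  with to (R⇔ σ) Rσ | to (R⇔ τ) Rτ
... | yσ , Sσ | yτ , Sτ =
  from (R⇔ ρ) (const false , Sat-union uc φ disjoint covers Sσ Sτ)
  where
  zero-sat : Sat φ (const {B = Fin m} false ++ const {B = Fin l} false)
  zero-sat = Sat-zero zv φ (++-const {m = m} {l} {x = const false} {y = const false}
                                     (λ _ → refl) (λ _ → refl))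

  -- The zero assignment satisfies φ, which fixes every frozen constant to false.
  frozen-false : ∀ {z y} → Sat φ (z ++ y) → y ≗ const false
  frozen-false {z} {y} S j =
    trans (proj₂ (frozen j) z y S) (sym (proj₂ (frozen j) (const false) (const false) zero-sat))

  disjoint : Disjoint (σ ++ yσ) (τ ++ yτ)
  disjoint i = trans (zipWith-++ _∧_ σ yσ τ yτ i)
                     (++-const σ∩τ (λ j → cong (_∧ yτ j) (frozen-false Sσ j)) i)

  covers : ρ ++ const false ≗ (σ ++ yσ) ∪ (τ ++ yτ)
  covers i = trans (++-cong {ys = const false} {ys′ = yσ ∪ yτ} ρ (σ ∪ τ)
                            ρ≗σ∪τ false≗yσ∪yτ i)
                   (sym (zipWith-++ _∨_ σ yσ τ yτ i))
    where
    false≗yσ∪yτ : const false ≗ yσ ∪ yτ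
    false≗yσ∪yτ j = sym (cong₂ _∨_ (frozen-false Sσ j) (frozen-false Sτ j))

fppDef-rel : (Γ : Lang) (s : Sym Γ) → Congruent (rel Γ s) → FppDef Γ (rel Γ s)
fppDef-rel Γ s R-cong = 0 , [ rAtom s (_↑ˡ 0) ] , R⇔ , λ ()
  where
  R⇔ : ∀ z → rel Γ s z ≡ true ⇔
             Σ (Fin 0 → Bool) λ y → Sat [ rAtom s (_↑ˡ 0) ] (z ++ y)
  R⇔ z = mk⇔ (λ r → []ᵛ , trans (R-cong (lookup-++ˡ z []ᵛ)) r ∷ [])
              (λ { (y , p ∷ []) → trans (sym (R-cong (lookup-++ˡ z y))) p })

QfDefinable : (Δ : Lang) {m : ℕ} → BRel m → Set
QfDefinable Δ {m} R = Σ (List (Atom Δ m)) λ ψ → ∀ z → R z ≡ true ⇔ Sat ψ z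

renameAtom : ∀ {Δ u v} → (Fin u → Fin v) → Atom Δ u → Atom Δ v
renameAtom g (rAtom s xs) = rAtom s (g ∘ xs)
renameAtom g (eqAtom x y) = eqAtom (g x) (g y)

satAtom-rename : ∀ {Δ u v} (g : Fin u → Fin v) {σ : Fin v → Bool} (a : Atom Δ u) →
                 satAtom σ (renameAtom g a) ⇔ satAtom (σ ∘ g) a
satAtom-rename g (rAtom s xs) = mk⇔ id id
satAtom-rename g (eqAtom x y) = mk⇔ id id

Sat-rename : ∀ {Δ u v} (g : Fin u → Fin v) (ψ : List (Atom Δ u)) (σ : Fin v → Bool) →
             Sat (map (renameAtom g) ψ) σ ⇔ Sat ψ (σ ∘ g)
Sat-rename g ψ σ =
  mk⇔ (All.map (λ {a} → to (satAtom-rename g a)) ∘ map⁻)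
      (map⁺ ∘ All.map (λ {a} → from (satAtom-rename g a)))

module Translation {Γ Δ : Lang} (def : ∀ s → QfDefinable Δ (rel Γ s)) where

  translateAtom : ∀ {v} → Atom Γ v → List (Atom Δ v)
  translateAtom (rAtom s xs) = map (renameAtom xs) (proj₁ (def s))
  translateAtom (eqAtom x y) = [ eqAtom x y ]

  satAtom-translate : ∀ {v} {σ : Fin v → Bool} (a : Atom Γ v) →
                      satAtom σ a ⇔ Sat (translateAtom a) σ
  satAtom-translate {σ = σ} (rAtom s xs) =
    ⇔-sym (Sat-rename xs (proj₁ (def s)) σ) ⇔-∘ proj₂ (def s) (σ ∘ xs)
  satAtom-translate (eqAtom x y) = mk⇔ (_∷ []) (λ { (p ∷ []) → p })

  Sat-translate : ∀ {v} (φ : List (Atom Γ v)) (σ : Fin v → Bool) →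
                  Sat φ σ ⇔ Sat (concatMap translateAtom φ) σ
  Sat-translate φ σ =
    mk⇔ (concat⁺ ∘ map⁺ ∘ All.map (λ {a} → to (satAtom-translate a)))
        (All.map (λ {a} → from (satAtom-translate a)) ∘ map⁻ ∘ concat⁻)

⊆fr-byQfDefinable : ∀ {Γ Δ} → (∀ s → QfDefinable Δ (rel Γ s)) → Γ ⊆fr Δ
⊆fr-byQfDefinable def m R (l , φ , R⇔ , frozen) =
  l , φ′ , R⇔′ , frozen′
  where
  open Translation def

  φ′ : List (Atom _ (m + l))
  φ′ = concatMap translateAtom φ

  R⇔′ : ∀ z → R z ≡ true ⇔ Σ (Fin l → Bool) λ y → Sat φ′ (z ++ y)
  R⇔′ z = mk⇔ (map₂ (to (Sat-translate φ _)) ∘ to (R⇔ z))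
               (from (R⇔ z) ∘ map₂ (from (Sat-translate φ _)))

  frozen′ : ∀ j → Σ Bool λ b → ∀ z y → Sat φ′ (z ++ y) → y j ≡ b
  frozen′ j = proj₁ (frozen j) ,
              λ z y S → proj₂ (frozen j) z y (from (Sat-translate φ (z ++ y)) S)

x-var : ∀ n → Fin (n + 2)
x-var n = n ↑ʳ zero

c₀-var : ∀ n → Fin (n + 2)
c₀-var n = n ↑ʳ suc zero

xᵢ→x : ∀ {n} → Fin n → Atom (Γp n) (n + 2)
xᵢ→x {n} i = rAtom impS ((i ↑ˡ 2) ∷ᵛ x-var n ∷ᵛ []ᵛ)

Rw-constraints : ∀ k → List (Atom (Γp (suc k)) (suc k + 2))
Rw-constraints k =
  rAtom nandS (_↑ˡ 2) ∷ rAtom nandS (const (c₀-var (suc k))) ∷ tabulate xᵢ→x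

Rw-conjuncts : ∀ n (t : Fin (n + 2) → Bool) → Rw n t ≡ true →
               NAND n (t ∘ (_↑ˡ 2)) ≡ true ×
               t (x-var n) ∨ allB (not ∘ t ∘ (_↑ˡ 2)) ≡ true ×
               not (t (c₀-var n)) ≡ true
Rw-conjuncts n t Rt with ∧-≡-true (NAND n (t ∘ (_↑ˡ 2))) Rt
... | nand , rest = nand , ∧-≡-true (t (x-var n) ∨ allB (not ∘ t ∘ (_↑ˡ 2))) rest

xsBelowX⇔Sat-imps : ∀ {n} (t : Fin (n + 2) → Bool) →
                    t (x-var n) ∨ allB (not ∘ t ∘ (_↑ˡ 2)) ≡ true ⇔
                    Sat (tabulate xᵢ→x) t
xsBelowX⇔Sat-imps {n} t =
  mk⇔ (tabulate⁺ {f = xᵢ→x} ∘ to allB-≡-true ∘ trans (sym x∨xs≡))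
      (trans x∨xs≡ ∘ from allB-≡-true ∘ tabulate⁻ {f = xᵢ→x})
  where
  x∨xs≡ : t (x-var n) ∨ allB (not ∘ t ∘ (_↑ˡ 2)) ≡
          allB (λ i → not (t (i ↑ˡ 2)) ∨ t (x-var n))
  x∨xs≡ = ∨-allB (t (x-var n)) (not ∘ t ∘ (_↑ˡ 2))

Rw-qfDefinable : ∀ k → QfDefinable (Γp (suc k)) (Rw (suc k))
Rw-qfDefinable k = Rw-constraints k , λ t → mk⇔ (sound t) (complete t)
  where
  notC₀≡ : ∀ t → NAND (suc k) (const (t (c₀-var (suc k)))) ≡ not (t (c₀-var (suc k)))
  notC₀≡ t = NAND-const {k} (t (c₀-var (suc k)))

  sound : ∀ t → Rw (suc k) t ≡ true → Sat (Rw-constraints k) t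
  sound t Rt with Rw-conjuncts (suc k) t Rt
  ... | nand , xsBelowX , notC₀ =
    nand ∷ trans (notC₀≡ t) notC₀ ∷ to (xsBelowX⇔Sat-imps t) xsBelowX

  complete : ∀ t → Sat (Rw-constraints k) t → Rw (suc k) t ≡ true
  complete t (nand ∷ notC₀ ∷ imps) =
    ≡-true-∧ nand (≡-true-∧ (from (xsBelowX⇔Sat-imps t) imps)
                            (trans (sym (notC₀≡ t)) notC₀))

Rw-cong : ∀ {n} → Congruent (Rw n)
Rw-cong {n} eq =
  cong₂ _∧_ (NAND-cong (eq ∘ (_↑ˡ 2)))
    (cong₂ _∧_ (cong₂ _∨_ (eq (x-var n)) (allB-cong (cong not ∘ eq ∘ (_↑ˡ 2))))
               (cong not (eq (c₀-var n))))

Rw-zeroValid : ∀ {k} → ZeroValid (Rw (suc k))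
Rw-zeroValid {k} t≗0 = trans (Rw-cong {suc k} t≗0) (cong (_∧ true) (allB-const-true {k}))

Rw-x-false⇒zero : ∀ {n} {t : Fin (n + 2) → Bool} →
                  Rw n t ≡ true → t (x-var n) ≡ false → t ≗ const false
Rw-x-false⇒zero {n} {t} Rt x≡false with Rw-conjuncts n t Rt
... | _ , xsBelowX , notC₀ =
  ↑-elim n xs≡false λ { zero → x≡false ; (suc zero) → not-≡-true notC₀ }
  where
  xs≡false : ∀ i → t (i ↑ˡ 2) ≡ false
  xs≡false i = not-≡-true (to allB-≡-true
    (subst (λ b → b ∨ allB (not ∘ t ∘ (_↑ˡ 2)) ≡ true) x≡false xsBelowX) i)

Rw-unionClosed : ∀ {n} → UnionClosed (Rw n)
Rw-unionClosed {n} σ τ ρ σ∩τ ρ≗σ∪τ Rσ Rτ = byX (σ (x-var n)) refl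
  where
  byX : ∀ b → σ (x-var n) ≡ b → Rw n ρ ≡ true
  byX false σx = trans (Rw-cong {n} ρ≗τ) Rτ
    where
    ρ≗τ : ρ ≗ τ
    ρ≗τ i = trans (ρ≗σ∪τ i) (cong (_∨ τ i) (Rw-x-false⇒zero {n} Rσ σx i))
  byX true σx = trans (Rw-cong {n} ρ≗σ) Rσ
    where
    τx : τ (x-var n) ≡ false
    τx = trans (sym (cong (_∧ τ (x-var n)) σx)) (σ∩τ (x-var n))

    ρ≗σ : ρ ≗ σ
    ρ≗σ i = trans (ρ≗σ∪τ i)
                  (trans (cong (σ i ∨_) (Rw-x-false⇒zero {n} Rτ τx i)) (∨-identityʳ (σ i)))

NAND-not-unionClosed : ∀ {k} → ¬ UnionClosed (NAND (suc (suc k)))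
NAND-not-unionClosed {k} uc = not-¬ (NAND-const-true {suc (suc k)}) all-ones
  where
  all-ones : NAND (suc (suc k)) (const true) ≡ true
  all-ones = uc (true ∷ᵛ const false) (false ∷ᵛ const true) (const true)
                (λ { zero → refl ; (suc _) → refl }) (λ { zero → refl ; (suc _) → refl })
                refl refl

lemma25 : (n : ℕ) → 2 ≤ n → Γw n ⊊fr Γp n
lemma25 (suc (suc k)) (s≤s (s≤s _)) =
  ⊆fr-byQfDefinable (λ _ → Rw-qfDefinable (suc k)) ,
  suc (suc k) , NAND (suc (suc k)) ,
  fppDef-rel (Γp (suc (suc k))) nandS NAND-cong ,
  NAND-not-unionClosed ∘
    fppDef-unionClosed (λ _ → Rw-zeroValid {suc k}) (λ _ → Rw-unionClosed {suc (suc k)})
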